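{- The center $c$ has the following properties. (1) For every deficient $m\in\mathbb{N}$, $c(m)=\frac{2m}{d(m)}-1=\dfrac{1}{\frac{2}{\sigma_{ -1}(m)}-1}$. (2) If $m,n\in\mathbb{N}$, $n>1$ and $mn$ is deficient, then $c(mn)>c(m)$. (3) For every prime $p$, $c(p^e)$ is increasing in $e$, and $\lim_{e\to+\infty}c(p^e)=\frac{p}{p-2}$ (interpreted as $+\infty$ when $p=2$). (4) If $m$ is deficient and $p,q$ are primes coprime with $m$ with $q>p>c(m)$, then $c(mq)<c(mp)$.
   Context: For $n\in\mathbb{N}$, $\sigma(n)=\sum_{d\mid n}d$ and $\sigma_{ -1}(n)=\sigma(n)/n$. $n$ is deficient if $\sigma(n)<2n$. The deficiency is $d(n)=2n-\sigma(n)$ and the center of $n$ is $c(n)=\sigma(n)/d(n)$. -}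

module Defs where

open import Data.Nat as ℕ using (ℕ; zero; suc)
open import Data.Nat.Divisibility using (_∣?_)
open import Data.List using (List; filter; upTo; map)
open import Data.Nat.ListAction using (sum)
open import Data.Integer as ℤ using (ℤ; +_; -[1+_]; +[1+_])
open import Data.Rational as ℚ using (ℚ; mkℚ; 0ℚ; 1/_; _/_)

-- σ(n) = sum of the positive divisors of n (divisors d with 1 ≤ d ≤ n);
-- by this convention σ(0) = 0.
σ : ℕ → ℕ
σ n = sum (filter (_∣? n) (map suc (upTo n)))

Deficient : ℕ → Set
Deficient n = σ n ℕ.< 2 ℕ.* n

ℕ→ℚ : ℕ → ℚ
ℕ→ℚ n = (+ n) / 1

ℤ→ℚ : ℤ → ℚ
ℤ→ℚ z = z / 1

-- total reciprocal / division on ℚ (x / 0 := 0); only ever applied to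
-- nonzero denominators in the statement
inv₀ : ℚ → ℚ
inv₀ q@(mkℚ (+ zero) _ _) = 0ℚ
inv₀ q@(mkℚ +[1+ n ] _ _) = 1/ q
inv₀ q@(mkℚ -[1+ n ] _ _) = 1/ q

infixl 7 _÷₀_
_÷₀_ : ℚ → ℚ → ℚ
p ÷₀ q = p ℚ.* inv₀ q

σ₋₁ : ℕ → ℚ
σ₋₁ n = ℕ→ℚ (σ n) ÷₀ ℕ→ℚ n

def : ℕ → ℤ
def n = + (2 ℕ.* n) ℤ.- + σ n

c : ℕ → ℚ
c n = ℕ→ℚ (σ n) ÷₀ ℤ→ℚ (def n)

{-# OPTIONS --safe #-}

-- The centre c = σ/(2n − σ) = 1/(2/σ₋₁ − 1) is an increasing function of σ₋₁ on
-- deficient numbers, so comparing centres amounts to comparing σ(n)/n. The facts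
-- about σ all come from one decomposition: the divisors of m·n that n divides
-- are n times the divisors of m, so σ(m·n) = n·σ(m) + (the sum of the divisors of
-- m·n that n does not divide), and the last sum is at least 1, is 1 for
-- m·n = p^(e+1), and is σ(m) for a prime n = q ∤ m. Hence σ₋₁(mq) = σ₋₁(m)(1 + 1/q)
-- decreases in q, while c(m) < p is exactly what makes m·p deficient. For prime
-- powers the decomposition gives (p−1)σ(p^e) + 1 = p^(e+1), whence
-- p/(p−2) − c(p^e) = 2/((p−2)·d(p^e)) with (p−1)·d(p^e) = (p−2)p^e + 1.
module Submission where

open import Defs
open import Data.Nat as ℕ using (ℕ; suc; _^_)
open import Data.Nat.Primality using (Prime)
open import Data.Nat.Coprimality using (Coprime)
open import Data.Product using (_×_; ∃-syntax)
open import Relation.Binary.PropositionalEquality using (_≡_)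
open import Data.Rational as ℚ using (ℚ; 0ℚ; 1ℚ; ∣_∣)

open import Data.Bool using (true; false; if_then_else_)
open import Data.Empty using (⊥-elim)
open import Data.Integer as ℤ using (+[1+_]; -[1+_]; _⊖_)
import Data.Integer.Properties as ℤP
open ℤP using (pos-*; drop‿+<+; ⊖-≥; m-n≡m⊖n)
open import Data.List using ([]; _∷_; [_]; _++_; filter; map; applyUpTo; upTo)
open import Data.List.Properties using (applyUpTo-∷ʳ; map-++; map-upTo)
open import Data.Nat using (zero; pred; nonTrivial⇒n>1; _+_; _*_; _∸_; _≤_; _<_; z≤n; s≤s; >-nonZero)
open import Data.Nat.Coprimality using (coprime-divisor; 1-coprimeTo) renaming (sym to coprime-sym)
open import Data.Nat.Divisibility
open import Data.Nat.ListAction using (sum)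
open import Data.Nat.ListAction.Properties using (sum-++)
open import Data.Nat.Primality using (prime⇒irreducible; prime⇒nonZero; prime⇒nonTrivial; ¬prime[0]; ¬prime[1]; prime[2])
open import Data.Nat.Properties
open import Data.Nat.Tactic.RingSolver using (solve-∀)
open import Data.Product using (_,_)
open import Data.Rational using (mkℚ; toℚᵘ)
import Data.Rational.Properties as ℚP
open import Algebra.Properties.AbelianGroup ℚP.+-0-abelianGroup using (xyx⁻¹≈y; ⁻¹-anti-homo‿-)
open import Algebra.Properties.Group ℚP.+-0-group using (//-rightDividesʳ)
open import Data.Rational.Unnormalised as ℚᵘ using (mkℚᵘ; *≡*; *<*)
import Data.Rational.Unnormalised.Properties as ℚᵘP
open import Data.Sum using (inj₁; inj₂)
open import Function using (id; _∘_)
open import Level using (0ℓ)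
open import Relation.Binary.PropositionalEquality using (refl; sym; trans; cong; cong₂; subst; subst₂; module ≡-Reasoning)
open import Relation.Nullary using (¬_; does; yes; no)
open import Relation.Unary using (Pred; Decidable)
open import Relation.Unary.Properties using (∁?)

restrict : {P : Pred ℕ 0ℓ} → Decidable P → (ℕ → ℕ) → ℕ → ℕ
restrict P? f d = if does (P? d) then f d else 0

module _ {P : Pred ℕ 0ℓ} (P? : Decidable P) (f : ℕ → ℕ) where

  restrict-yes : ∀ {d} → P d → restrict P? f d ≡ f d
  restrict-yes {d} p with P? d
  ... | yes _  = refl
  ... | no ¬p = ⊥-elim (¬p p)

  restrict-no : ∀ {d} → ¬ P d → restrict P? f d ≡ 0
  restrict-no {d} ¬p with P? d
  ... | yes p = ⊥-elim (¬p p)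
  ... | no _  = refl

  restrict-split : ∀ d → f d ≡ restrict P? f d + restrict (∁? P?) f d
  restrict-split d with P? d
  ... | yes _ = sym (+-identityʳ (f d))
  ... | no _  = refl

  sum-filter : ∀ xs → sum (filter P? xs) ≡ sum (map (restrict P? id) xs)
  sum-filter []       = refl
  sum-filter (x ∷ xs) with does (P? x)
  ... | true  = cong (x +_) (sum-filter xs)
  ... | false = sum-filter xs

∑ : (ℕ → ℕ) → ℕ → ℕ
∑ f zero    = 0
∑ f (suc n) = ∑ f n + f (suc n)

sum-map-applyUpTo-suc : ∀ f n → sum (map f (applyUpTo suc n)) ≡ ∑ f n
sum-map-applyUpTo-suc f zero    = refl
sum-map-applyUpTo-suc f (suc n) = begin
  sum (map f (applyUpTo suc (suc n)))             ≡⟨ cong (sum ∘ map f) (applyUpTo-∷ʳ suc n) ⟨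
  sum (map f (applyUpTo suc n ++ [ suc n ]))      ≡⟨ cong sum (map-++ f (applyUpTo suc n) [ suc n ]) ⟩
  sum (map f (applyUpTo suc n) ++ [ f (suc n) ])  ≡⟨ sum-++ (map f (applyUpTo suc n)) [ f (suc n) ] ⟩
  sum (map f (applyUpTo suc n)) + (f (suc n) + 0) ≡⟨ cong₂ _+_ (sum-map-applyUpTo-suc f n) (+-identityʳ _) ⟩
  ∑ f n + f (suc n)                               ∎
  where open ≡-Reasoning

∑-cong : ∀ {f g} n → (∀ {d} → 1 ≤ d → d ≤ n → f d ≡ g d) → ∑ f n ≡ ∑ g n
∑-cong zero    eq = refl
∑-cong (suc n) eq = cong₂ _+_ (∑-cong n (λ 1≤d d≤n → eq 1≤d (m≤n⇒m≤1+n d≤n))) (eq (s≤s z≤n) ≤-refl)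

∑-vanishes : ∀ {f} n → (∀ {d} → 1 ≤ d → d ≤ n → f d ≡ 0) → ∑ f n ≡ 0
∑-vanishes zero    eq = refl
∑-vanishes (suc n) eq = cong₂ _+_ (∑-vanishes n (λ 1≤d d≤n → eq 1≤d (m≤n⇒m≤1+n d≤n))) (eq (s≤s z≤n) ≤-refl)

∑-+ : ∀ f g n → ∑ (λ d → f d + g d) n ≡ ∑ f n + ∑ g n
∑-+ f g zero    = refl
∑-+ f g (suc n) = trans (cong (_+ (f (suc n) + g (suc n))) (∑-+ f g n)) (interchange (∑ f n) (∑ g n) _ _)
  where
  interchange : ∀ a b c d → (a + b) + (c + d) ≡ (a + c) + (b + d)
  interchange = solve-∀

∑-*ˡ : ∀ k f n → ∑ (λ d → k * f d) n ≡ k * ∑ f n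
∑-*ˡ k f zero    = sym (*-zeroʳ k)
∑-*ˡ k f (suc n) = trans (cong (_+ k * f (suc n)) (∑-*ˡ k f n)) (sym (*-distribˡ-+ k (∑ f n) (f (suc n))))

∑-split : ∀ f k a → ∑ f (k + a) ≡ ∑ f a + ∑ (λ d → f (a + d)) k
∑-split f zero    a = sym (+-identityʳ (∑ f a))
∑-split f (suc k) a = begin
  ∑ f (k + a) + f (suc (k + a))                   ≡⟨ cong₂ _+_ (∑-split f k a) (cong f (sym a+1+k≡1+k+a)) ⟩
  ∑ f a + ∑ (λ d → f (a + d)) k + f (a + suc k)   ≡⟨ +-assoc (∑ f a) _ _ ⟩
  ∑ f a + ∑ (λ d → f (a + d)) (suc k)             ∎
  where
  open ≡-Reasoning
  a+1+k≡1+k+a : a + suc k ≡ suc (k + a)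
  a+1+k≡1+k+a = trans (+-suc a k) (cong suc (+-comm a k))

∑-truncate : ∀ {f} m n → m ≤ n → (∀ {d} → m < d → d ≤ n → f d ≡ 0) → ∑ f n ≡ ∑ f m
∑-truncate {f} m n m≤n vanish = begin
  ∑ f n                                ≡⟨ cong (∑ f) (m∸n+n≡m m≤n) ⟨
  ∑ f (n ∸ m + m)                      ≡⟨ ∑-split f (n ∸ m) m ⟩
  ∑ f m + ∑ (λ d → f (m + d)) (n ∸ m)  ≡⟨ cong (∑ f m +_) (∑-vanishes (n ∸ m) tail) ⟩
  ∑ f m + 0                            ≡⟨ +-identityʳ (∑ f m) ⟩
  ∑ f m                                ∎
  where
  open ≡-Reasoning
  tail : ∀ {d} → 1 ≤ d → d ≤ n ∸ m → f (m + d) ≡ 0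
  tail {d} 1≤d d≤ = vanish (m<m+n m 1≤d) (subst (m + d ≤_) (m+[n∸m]≡n m≤n) (+-monoʳ-≤ m d≤))

term≤∑ : ∀ f {n d} → 1 ≤ d → d ≤ n → f d ≤ ∑ f n
term≤∑ f {zero} (s≤s _) ()
term≤∑ f {suc n} {d} 1≤d d≤1+n with m≤n⇒m<n∨m≡n d≤1+n
... | inj₁ (s≤s d≤n) = ≤-trans (term≤∑ f 1≤d d≤n) (m≤m+n (∑ f n) (f (suc n)))
... | inj₂ refl      = m≤n+m (f (suc n)) (∑ f n)

∑-multiples : ∀ g n m → ∑ (restrict (suc n ∣?_) g) (m * suc n) ≡ ∑ (λ j → g (j * suc n)) m
∑-multiples g n zero    = refl
∑-multiples g n (suc m) = begin
  ∑ h (suc n + m * suc n)                                   ≡⟨ ∑-split h (suc n) (m * suc n) ⟩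
  ∑ h (m * suc n) + ∑ (λ d → h (m * suc n + d)) (suc n)     ≡⟨ cong₂ _+_ (∑-multiples g n m) block ⟩
  ∑ (λ j → g (j * suc n)) m + g (suc m * suc n)             ∎
  where
  open ≡-Reasoning
  h = restrict (suc n ∣?_) g
  block : ∑ (λ d → h (m * suc n + d)) (suc n) ≡ g (suc m * suc n)
  block = cong₂ _+_
    (∑-vanishes n (λ 1≤d d≤n → restrict-no (suc n ∣?_) g (λ n∣ →
      <⇒≱ (s≤s d≤n) (∣⇒≤ {{>-nonZero 1≤d}} (∣m+n∣m⇒∣n n∣ (n∣m*n m))))))
    (trans (restrict-yes (suc n ∣?_) g (∣m∣n⇒∣m+n (n∣m*n m) ∣-refl)) (cong g (+-comm (m * suc n) (suc n))))

divisor-term : ℕ → ℕ → ℕ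
divisor-term N = restrict (_∣? N) id

σ≡∑ : ∀ N → σ N ≡ ∑ (divisor-term N) N
σ≡∑ N = begin
  σ N                                                  ≡⟨ sum-filter (_∣? N) id (map suc (upTo N)) ⟩
  sum (map (divisor-term N) (map suc (upTo N)))        ≡⟨ cong (sum ∘ map (divisor-term N)) (map-upTo suc N) ⟩
  sum (map (divisor-term N) (applyUpTo suc N))         ≡⟨ sum-map-applyUpTo-suc (divisor-term N) N ⟩
  ∑ (divisor-term N) N                                 ∎
  where open ≡-Reasoning

n≤σ[n] : ∀ n → n ≤ σ n
n≤σ[n] zero    = z≤n
n≤σ[n] (suc n) = subst₂ _≤_ (restrict-yes (_∣? suc n) id ∣-refl) (sym (σ≡∑ (suc n)))
  (term≤∑ (divisor-term (suc n)) (s≤s z≤n) ≤-refl)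

prime∤⇒coprime : ∀ {q d} → Prime q → ¬ q ∣ d → Coprime d q
prime∤⇒coprime pq q∤d (e∣d , e∣q) with prime⇒irreducible pq e∣q
... | inj₁ e≡1  = e≡1
... | inj₂ refl = ⊥-elim (q∤d e∣d)

∣prime^⇒≡1 : ∀ {p d} e → Prime p → ¬ p ∣ d → d ∣ p ^ e → d ≡ 1
∣prime^⇒≡1 zero    _  _   d∣1    = ∣1⇒≡1 d∣1
∣prime^⇒≡1 (suc e) pp p∤d d∣p^1+e = ∣prime^⇒≡1 e pp p∤d (coprime-divisor (prime∤⇒coprime pp p∤d) d∣p^1+e)

σ∤ : ℕ → ℕ → ℕ
σ∤ n N = ∑ (restrict (∁? (n ∣?_)) (divisor-term N)) N

σ-*-split : ∀ m n → σ (m * suc n) ≡ suc n * σ m + σ∤ (suc n) (m * suc n)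
σ-*-split m n = begin
  σ (m * n′)
    ≡⟨ σ≡∑ (m * n′) ⟩
  ∑ t (m * n′)
    ≡⟨ ∑-cong (m * n′) (λ {d} _ _ → restrict-split (n′ ∣?_) t d) ⟩
  ∑ (λ d → restrict (n′ ∣?_) t d + restrict (∁? (n′ ∣?_)) t d) (m * n′)
    ≡⟨ ∑-+ (restrict (n′ ∣?_) t) _ (m * n′) ⟩
  ∑ (restrict (n′ ∣?_) t) (m * n′) + σ∤ n′ (m * n′)
    ≡⟨ cong (_+ σ∤ n′ (m * n′)) multiples ⟩
  n′ * σ m + σ∤ n′ (m * n′)
    ∎
  where
  open ≡-Reasoning
  n′ = suc n
  t = divisor-term (m * n′)
  scaled : ∀ j → t (j * n′) ≡ n′ * divisor-term m j
  scaled j with j ∣? m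
  ... | yes j∣m = trans (restrict-yes (_∣? m * n′) id (*-monoˡ-∣ n′ j∣m)) (*-comm j n′)
  ... | no j∤m  = trans (restrict-no (_∣? m * n′) id (j∤m ∘ *-cancelʳ-∣ n′)) (sym (*-zeroʳ n′))
  multiples : ∑ (restrict (n′ ∣?_) t) (m * n′) ≡ n′ * σ m
  multiples = begin
    ∑ (restrict (n′ ∣?_) t) (m * n′)  ≡⟨ ∑-multiples t n m ⟩
    ∑ (λ j → t (j * n′)) m            ≡⟨ ∑-cong m (λ {j} _ _ → scaled j) ⟩
    ∑ (λ j → n′ * divisor-term m j) m ≡⟨ ∑-*ˡ n′ (divisor-term m) m ⟩
    n′ * ∑ (divisor-term m) m         ≡⟨ cong (n′ *_) (σ≡∑ m) ⟨
    n′ * σ m                          ∎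

1≤σ∤ : ∀ {n N} → 1 < n → 1 ≤ N → 1 ≤ σ∤ n N
1≤σ∤ {n} {N} 1<n 1≤N = subst (_≤ σ∤ n N) one (term≤∑ (restrict (∁? (n ∣?_)) (divisor-term N)) ≤-refl 1≤N)
  where
  one : restrict (∁? (n ∣?_)) (divisor-term N) 1 ≡ 1
  one = trans (restrict-yes (∁? (n ∣?_)) (divisor-term N) (λ n∣1 → <⇒≢ 1<n (sym (∣1⇒≡1 n∣1))))
              (restrict-yes (_∣? N) id (1∣ N))

σ∤-prime-coprime : ∀ {q m} → Prime q → ¬ q ∣ m → σ∤ q (m * q) ≡ σ m
σ∤-prime-coprime {q} {zero}    _  q∤0 = ⊥-elim (q∤0 (q ∣0))
σ∤-prime-coprime {q} {m@(suc _)} pq q∤m = begin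
  σ∤ q (m * q)              ≡⟨ ∑-cong (m * q) (λ {d} _ _ → pointwise d) ⟩
  ∑ (divisor-term m) (m * q) ≡⟨ ∑-truncate m (m * q) (m≤m*n m q {{prime⇒nonZero pq}}) beyond ⟩
  ∑ (divisor-term m) m       ≡⟨ σ≡∑ m ⟨
  σ m                        ∎
  where
  open ≡-Reasoning
  pointwise : ∀ d → restrict (∁? (q ∣?_)) (divisor-term (m * q)) d ≡ divisor-term m d
  pointwise d with q ∣? d
  ... | yes q∣d = sym (restrict-no (_∣? m) id (λ d∣m → q∤m (∣-trans q∣d d∣m)))
  ... | no q∤d with d ∣? m
  ...   | yes d∣m = restrict-yes (_∣? m * q) id (∣-trans d∣m (m∣m*n q))
  ...   | no d∤m  = restrict-no (_∣? m * q) id (λ d∣mq →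
          d∤m (coprime-divisor (prime∤⇒coprime pq q∤d) (subst (d ∣_) (*-comm m q) d∣mq)))
  beyond : ∀ {d} → m < d → d ≤ m * q → divisor-term m d ≡ 0
  beyond m<d _ = restrict-no (_∣? m) id (λ d∣m → <⇒≱ m<d (∣⇒≤ d∣m))

σ∤-prime-power : ∀ {p} e → Prime p → σ∤ p (p ^ e * p) ≡ 1
σ∤-prime-power {p} e pp = begin
  σ∤ p P  ≡⟨ ∑-truncate 1 P 1≤P beyond ⟩
  f 1     ≡⟨ restrict-yes (∁? (p ∣?_)) (divisor-term P) (λ p∣1 → ¬prime[1] (subst Prime (∣1⇒≡1 p∣1) pp)) ⟩
  divisor-term P 1 ≡⟨ restrict-yes (_∣? P) id (1∣ P) ⟩
  1       ∎
  where
  open ≡-Reasoning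
  instance _ = prime⇒nonZero pp
  P = p ^ e * p
  f = restrict (∁? (p ∣?_)) (divisor-term P)
  1≤P : 1 ≤ P
  1≤P = subst (1 ≤_) (*-comm p (p ^ e)) (m^n>0 p (suc e))
  beyond : ∀ {d} → 1 < d → d ≤ P → f d ≡ 0
  beyond {d} 1<d _ with p ∣? d
  ... | yes _   = refl
  ... | no p∤d = restrict-no (_∣? P) id (λ d∣P →
        <⇒≢ 1<d (sym (∣prime^⇒≡1 (suc e) pp p∤d (subst (d ∣_) (*-comm (p ^ e) p) d∣P))))

σ-*-> : ∀ m {n} → 1 < n → 1 ≤ m → n * σ m < σ (m * n)
σ-*-> m {suc n} 1<n 1≤m = subst (suc n * σ m <_) (sym (σ-*-split m n))
  (m<m+n (suc n * σ m) (1≤σ∤ 1<n (*-mono-≤ 1≤m (<⇒≤ 1<n))))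

σ-*-prime : ∀ {m q} → Prime q → ¬ q ∣ m → σ (m * q) ≡ suc q * σ m
σ-*-prime {m} {zero}  pq _   = ⊥-elim (¬prime[0] pq)
σ-*-prime {m} {suc q} pq q∤m = begin
  σ (m * suc q)                     ≡⟨ σ-*-split m q ⟩
  suc q * σ m + σ∤ (suc q) (m * suc q) ≡⟨ cong (suc q * σ m +_) (σ∤-prime-coprime pq q∤m) ⟩
  suc q * σ m + σ m                 ≡⟨ +-comm (suc q * σ m) (σ m) ⟩
  suc (suc q) * σ m                 ∎
  where open ≡-Reasoning

σ-prime-power-suc : ∀ {p} e → Prime p → σ (p ^ suc e) ≡ p * σ (p ^ e) + 1
σ-prime-power-suc {zero}  e pp = ⊥-elim (¬prime[0] pp)
σ-prime-power-suc {suc p} e pp = begin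
  σ (suc p * suc p ^ e)
    ≡⟨ cong σ (*-comm (suc p) (suc p ^ e)) ⟩
  σ (suc p ^ e * suc p)
    ≡⟨ σ-*-split (suc p ^ e) p ⟩
  suc p * σ (suc p ^ e) + σ∤ (suc p) (suc p ^ e * suc p)
    ≡⟨ cong (suc p * σ (suc p ^ e) +_) (σ∤-prime-power e pp) ⟩
  suc p * σ (suc p ^ e) + 1
    ∎
  where open ≡-Reasoning

σ-prime-power : ∀ {p} e → Prime p → pred p * σ (p ^ e) + 1 ≡ p ^ suc e
σ-prime-power {zero}  e       pp = ⊥-elim (¬prime[0] pp)
σ-prime-power {suc p} zero    pp = base p
  where
  base : ∀ p → p * 1 + 1 ≡ suc p * 1
  base = solve-∀
σ-prime-power {suc p} (suc e) pp = begin
  p * σ (suc p ^ suc e) + 1           ≡⟨ cong (λ s → p * s + 1) (σ-prime-power-suc e pp) ⟩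
  p * (suc p * σ (suc p ^ e) + 1) + 1 ≡⟨ step p (σ (suc p ^ e)) ⟩
  suc p * (p * σ (suc p ^ e) + 1)     ≡⟨ cong (suc p *_) (σ-prime-power e pp) ⟩
  suc p * suc p ^ suc e               ∎
  where
  open ≡-Reasoning
  step : ∀ p s → p * (suc p * s + 1) + 1 ≡ suc p * (p * s + 1)
  step = solve-∀

prime-power-deficient : ∀ {p} e → Prime p → Deficient (p ^ e)
prime-power-deficient         zero    pp = ≤-refl
prime-power-deficient {p} (suc e) pp = subst (_< 2 * p ^ suc e) (sym (σ-prime-power-suc e pp)) (begin-strict
  p * σ (p ^ e) + 1       <⟨ +-monoʳ-< (p * σ (p ^ e)) (nonTrivial⇒n>1 p {{prime⇒nonTrivial pp}}) ⟩
  p * σ (p ^ e) + p       ≡⟨ +-comm (p * σ (p ^ e)) p ⟩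
  p + p * σ (p ^ e)       ≡⟨ *-suc p (σ (p ^ e)) ⟨
  p * suc (σ (p ^ e))     ≤⟨ *-monoʳ-≤ p (prime-power-deficient e pp) ⟩
  p * (2 * p ^ e)         ≡⟨ swap p 2 (p ^ e) ⟩
  2 * p ^ suc e           ∎)
  where
  open ≤-Reasoning
  swap : ∀ p a b → p * (a * b) ≡ a * (p * b)
  swap = solve-∀

-- x ≐ a /1+ b says x = a/(1+b); it turns every equation and inequality
-- between the rationals below into one between natural numbers.
infix 4 _≐_/1+_
_≐_/1+_ : ℚ → ℕ → ℕ → Set
x ≐ a /1+ b = toℚᵘ x ℚᵘ.≃ mkℚᵘ (ℤ.+ a) b

fraction-≃ : ∀ {a b c d} → a * suc d ≡ c * suc b → mkℚᵘ (ℤ.+ a) b ℚᵘ.≃ mkℚᵘ (ℤ.+ c) d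
fraction-≃ {a} {b} {c} {d} eq =
  *≡* (trans (sym (pos-* a (suc d))) (trans (cong ℤ.+_ eq) (pos-* c (suc b))))

fraction-< : ∀ {a b c d} → a * suc d < c * suc b → mkℚᵘ (ℤ.+ a) b ℚᵘ.< mkℚᵘ (ℤ.+ c) d
fraction-< {a} {b} {c} {d} lt =
  *<* (subst₂ ℤ._<_ (pos-* a (suc d)) (pos-* c (suc b)) (ℤ.+<+ lt))

fraction-<⁻ : ∀ {a b c d} → mkℚᵘ (ℤ.+ a) b ℚᵘ.< mkℚᵘ (ℤ.+ c) d → a * suc d < c * suc b
fraction-<⁻ {a} {b} {c} {d} (*<* lt) =
  drop‿+<+ (subst₂ ℤ._<_ (sym (pos-* a (suc d))) (sym (pos-* c (suc b))) lt)

module _ {x y : ℚ} {a b c d : ℕ} where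

  ≐-≡ : x ≐ a /1+ b → y ≐ c /1+ d → a * suc d ≡ c * suc b → x ≡ y
  ≐-≡ x≐ y≐ eq = ℚP.toℚᵘ-injective (ℚᵘP.≃-trans x≐ (ℚᵘP.≃-trans (fraction-≃ eq) (ℚᵘP.≃-sym y≐)))

  ≐-< : x ≐ a /1+ b → y ≐ c /1+ d → a * suc d < c * suc b → x ℚ.< y
  ≐-< x≐ y≐ lt = ℚP.toℚᵘ-cancel-< (ℚᵘP.<-respˡ-≃ (ℚᵘP.≃-sym x≐) (ℚᵘP.<-respʳ-≃ (ℚᵘP.≃-sym y≐) (fraction-< lt)))

  ≐-<⁻ : x ≐ a /1+ b → y ≐ c /1+ d → x ℚ.< y → a * suc d < c * suc b
  ≐-<⁻ x≐ y≐ x<y = fraction-<⁻ (ℚᵘP.<-respˡ-≃ x≐ (ℚᵘP.<-respʳ-≃ y≐ (ℚP.toℚᵘ-mono-< x<y)))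

  ≐-* : x ≐ a /1+ b → y ≐ c /1+ d → x ℚ.* y ≐ a * c /1+ (d + b * suc d)
  ≐-* x≐ y≐ = ℚᵘP.≃-trans (ℚP.toℚᵘ-homo-* x y) (ℚᵘP.≃-trans (ℚᵘP.*-cong x≐ y≐)
    (*≡* (cong (ℤ._* ℤ.+ suc (d + b * suc d)) (sym (pos-* a c)))))

  ≐-+ : x ≐ a /1+ b → y ≐ c /1+ d → x ℚ.+ y ≐ a * suc d + c * suc b /1+ (d + b * suc d)
  ≐-+ x≐ y≐ = ℚᵘP.≃-trans (ℚP.toℚᵘ-homo-+ x y) (ℚᵘP.≃-trans (ℚᵘP.+-cong x≐ y≐)
    (*≡* (cong (ℤ._* ℤ.+ suc (d + b * suc d)) (cong₂ ℤ._+_ (sym (pos-* a (suc d))) (sym (pos-* c (suc b)))))))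

≐-resp : ∀ {x a b c d} → x ≐ a /1+ b → a * suc d ≡ c * suc b → x ≐ c /1+ d
≐-resp x≐ eq = ℚᵘP.≃-trans x≐ (fraction-≃ eq)

≐-ℕ : ∀ n → ℕ→ℚ n ≐ n /1+ 0
≐-ℕ n rewrite ℚP.normalize-coprime (coprime-sym (1-coprimeTo n)) = ℚᵘP.≃-refl

≐-inv₀ : ∀ {x a b} → x ≐ suc a /1+ b → inv₀ x ≐ suc b /1+ a
≐-inv₀ {mkℚ (ℤ.+ zero) d _} {a} {b} (*≡* eq) =
  ⊥-elim (0≢1+n (ℤP.+-injective (trans eq (sym (pos-* (suc a) (suc d))))))
≐-inv₀ {mkℚ +[1+ n ] d _} {a} {b} (*≡* eq) = fraction-≃
  (trans (*-comm (suc d) (suc a)) (trans (sym (ℤP.+-injective eq′)) (*-comm (suc n) (suc b))))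
  where
  eq′ : ℤ.+ (suc n * suc b) ≡ ℤ.+ (suc a * suc d)
  eq′ = trans (pos-* (suc n) (suc b)) (trans eq (sym (pos-* (suc a) (suc d))))
≐-inv₀ {mkℚ -[1+ n ] d _} {a} {b} (*≡* eq) with trans eq (sym (pos-* (suc a) (suc d)))
... | ()

≐-÷₀ : ∀ {x y a b c d} → x ≐ a /1+ b → y ≐ suc c /1+ d → x ÷₀ y ≐ a * suc d /1+ (c + b * suc c)
≐-÷₀ x≐ y≐ = ≐-* x≐ (≐-inv₀ y≐)

≐-ℕ÷ℕ : ∀ a b → ℕ→ℚ a ÷₀ ℕ→ℚ (suc b) ≐ a /1+ b
≐-ℕ÷ℕ a b = ≐-resp (≐-÷₀ (≐-ℕ a) (≐-ℕ (suc b))) (cross a b)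
  where
  cross : ∀ a b → a * 1 * suc b ≡ a * suc (b + 0 * suc b)
  cross = solve-∀

≐-minus-1 : ∀ {x a b} → x ≐ a + suc b /1+ b → x ℚ.- 1ℚ ≐ a /1+ b
≐-minus-1 {x} {a} {b} x≐ = subst (_≐ a /1+ b) (sym x-1≡y) (≐-ℕ÷ℕ a b)
  where
  y = ℕ→ℚ a ÷₀ ℕ→ℚ (suc b)
  cross : ∀ a b → (a + suc b) * suc (0 + b * 1) ≡ (a * 1 + 1 * suc b) * suc b
  cross = solve-∀
  x≡y+1 : x ≡ y ℚ.+ 1ℚ
  x≡y+1 = ≐-≡ x≐ (≐-+ (≐-ℕ÷ℕ a b) (≐-ℕ 1)) (cross a b)
  x-1≡y : x ℚ.- 1ℚ ≡ y
  x-1≡y = trans (cong (ℚ._- 1ℚ) x≡y+1) (//-rightDividesʳ 1ℚ y)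

deficiency-gap : ∀ n → Deficient n → ∃[ k ] σ n + suc k ≡ 2 * n
deficiency-gap n dn = 2 * n ∸ suc (σ n) , trans (+-suc (σ n) _) (m+[n∸m]≡n dn)

def≡ : ∀ n {k} → σ n + suc k ≡ 2 * n → def n ≡ ℤ.+ suc k
def≡ n {k} gap = begin
  ℤ.+ (2 * n) ℤ.- ℤ.+ σ n  ≡⟨ m-n≡m⊖n (2 * n) (σ n) ⟩
  2 * n ⊖ σ n              ≡⟨ ⊖-≥ (subst (σ n ≤_) gap (m≤m+n (σ n) (suc k))) ⟩
  ℤ.+ (2 * n ∸ σ n)        ≡⟨ cong (λ t → ℤ.+ (t ∸ σ n)) gap ⟨
  ℤ.+ (σ n + suc k ∸ σ n)  ≡⟨ cong ℤ.+_ (m+n∸m≡n (σ n) (suc k)) ⟩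
  ℤ.+ suc k                ∎
  where open ≡-Reasoning

÷def≐ : ∀ n {k} a → σ n + suc k ≡ 2 * n → ℕ→ℚ a ÷₀ ℤ→ℚ (def n) ≐ a /1+ k
÷def≐ n {k} a gap = subst (λ d → ℕ→ℚ a ÷₀ ℤ→ℚ d ≐ a /1+ k) (sym (def≡ n gap)) (≐-ℕ÷ℕ a k)

c≐ : ∀ n {k} → σ n + suc k ≡ 2 * n → c n ≐ σ n /1+ k
c≐ n = ÷def≐ n (σ n)

cross-gap : ∀ {K L} s t m n → s + K ≡ 2 * m → t + L ≡ 2 * n → s * n < t * m → s * L < t * K
cross-gap {K} {L} s t m n gapˡ gapʳ sn<tm = +-cancelʳ-< (s * t) (s * L) (t * K)
  (subst₂ _<_ (sym (rearrange s t L n gapʳ)) (sym right) (*-monoʳ-< 2 sn<tm))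
  where
  expand : ∀ s t L n → s * L + s * t ≡ s * (t + L)
  expand = solve-∀
  swap : ∀ s n → s * (2 * n) ≡ 2 * (s * n)
  swap = solve-∀
  rearrange : ∀ s t L n → t + L ≡ 2 * n → s * L + s * t ≡ 2 * (s * n)
  rearrange s t L n gap = trans (expand s t L n) (trans (cong (s *_) gap) (swap s n))
  right : t * K + s * t ≡ 2 * (t * m)
  right = subst (λ u → t * K + u ≡ 2 * (t * m)) (*-comm t s) (rearrange t s K m gapˡ)

σ₋₁-<⇒c-< : ∀ m n → Deficient m → Deficient n → σ m * n < σ n * m → c m ℚ.< c n
σ₋₁-<⇒c-< m n dm dn lt with deficiency-gap m dm | deficiency-gap n dn
... | k , gapₘ | l , gapₙ = ≐-< (c≐ m gapₘ) (c≐ n gapₙ) (cross-gap (σ m) (σ n) m n gapₘ gapₙ lt)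

c≡2m/d-1 : ∀ m → Deficient m → c m ≡ ℕ→ℚ (2 * m) ÷₀ ℤ→ℚ (def m) ℚ.- 1ℚ
c≡2m/d-1 m dm with deficiency-gap m dm
... | k , gap = ≐-≡ (c≐ m gap) (≐-minus-1 2m/d≐) refl
  where
  2m/d≐ : ℕ→ℚ (2 * m) ÷₀ ℤ→ℚ (def m) ≐ σ m + suc k /1+ k
  2m/d≐ = subst (λ t → ℕ→ℚ (2 * m) ÷₀ ℤ→ℚ (def m) ≐ t /1+ k) (sym gap) (÷def≐ m (2 * m) gap)

c≡1/[2/σ₋₁-1] : ∀ m → Deficient m → c m ≡ 1ℚ ÷₀ (ℕ→ℚ 2 ÷₀ σ₋₁ m ℚ.- 1ℚ)
c≡1/[2/σ₋₁-1] (suc m) dm with deficiency-gap (suc m) dm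
... | k , gap = ≐-≡ (c≐ (suc m) gap) (≐-÷₀ (≐-ℕ 1) (≐-minus-1 2/σ₋₁≐)) cross
  where
  s = pred (σ (suc m))
  1+s≡σ : suc s ≡ σ (suc m)
  1+s≡σ = suc-pred (σ (suc m)) {{>-nonZero (≤-trans (s≤s z≤n) (n≤σ[n] (suc m)))}}
  σ₋₁≐ : σ₋₁ (suc m) ≐ suc s /1+ m
  σ₋₁≐ = subst (λ t → σ₋₁ (suc m) ≐ t /1+ m) (sym 1+s≡σ) (≐-ℕ÷ℕ (σ (suc m)) m)
  2/σ₋₁≐ : ℕ→ℚ 2 ÷₀ σ₋₁ (suc m) ≐ suc k + suc s /1+ s
  2/σ₋₁≐ = ≐-resp (≐-÷₀ (≐-ℕ 2) σ₋₁≐)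
    (trans (cong (_* suc s) (sym (trans (cong (_+ suc k) 1+s≡σ) gap))) (shape k s))
    where
    shape : ∀ k s → (suc s + suc k) * suc s ≡ (suc k + suc s) * suc (s + 0 * suc s)
    shape = solve-∀
  cross : σ (suc m) * suc (k + 0 * suc k) ≡ 1 * suc s * suc k
  cross = trans (cong (_* suc (k + 0 * suc k)) (sym 1+s≡σ)) (shape s k)
    where
    shape : ∀ s k → suc s * suc (k + 0 * suc k) ≡ 1 * suc s * suc k
    shape = solve-∀

c-<-* : ∀ m n → 1 < n → Deficient (m * n) → c m ℚ.< c (m * n)
c-<-* zero    n 1<n ()
c-<-* (suc m) n 1<n dmn = σ₋₁-<⇒c-< (suc m) (suc m * n) dm dmn
  (subst (_< σ (suc m * n) * suc m) (regroup n (σ (suc m)) (suc m)) (*-monoˡ-< (suc m) growth))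
  where
  growth : n * σ (suc m) < σ (suc m * n)
  growth = σ-*-> (suc m) 1<n (s≤s z≤n)
  swap : ∀ n m → 2 * (m * n) ≡ n * (2 * m)
  swap = solve-∀
  regroup : ∀ n s m → n * s * m ≡ s * (m * n)
  regroup = solve-∀
  dm : Deficient (suc m)
  dm = *-cancelˡ-< n (σ (suc m)) (2 * suc m) (<-trans growth (subst (σ (suc m * n) <_) (swap n (suc m)) dmn))

c-prime-power-< : ∀ {p} e → Prime p → c (p ^ e) ℚ.< c (p ^ suc e)
c-prime-power-< {p} e pp = subst (λ t → c (p ^ e) ℚ.< c t) (*-comm (p ^ e) p)
  (c-<-* (p ^ e) p (nonTrivial⇒n>1 p {{prime⇒nonTrivial pp}})
    (subst Deficient (*-comm p (p ^ e)) (prime-power-deficient (suc e) pp)))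

n<m^n : ∀ {m} n → 1 < m → n < m ^ n
n<m^n         zero    _   = s≤s z≤n
n<m^n {m} (suc n) 1<m = begin-strict
  suc n          ≤⟨ n<m^n n 1<m ⟩
  m ^ n          <⟨ m<m+n (m ^ n) (≤-trans (s≤s z≤n) (n<m^n n 1<m)) ⟩
  m ^ n + m ^ n  ≡⟨ cong (m ^ n +_) (+-identityʳ (m ^ n)) ⟨
  2 * m ^ n      ≤⟨ *-monoˡ-≤ (m ^ n) 1<m ⟩
  m * m ^ n      ∎
  where open ≤-Reasoning

exceeding-ℕ : ∀ (M : ℚ) → ∃[ K ] M ℚ.< ℕ→ℚ K
exceeding-ℕ M@(mkℚ (ℤ.+ a) d _) = suc a , ≐-< {M} ℚᵘP.≃-refl (≐-ℕ (suc a))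
  (subst (_< suc a * suc d) (sym (*-identityʳ a)) (m≤m*n (suc a) (suc d)))
exceeding-ℕ M@(mkℚ -[1+ a ] d _) = 0 , ℚP.negative⁻¹ M

c-2^-unbounded : ∀ M → ∃[ N ] ∀ e → N ≤ e → M ℚ.< c (2 ^ e)
c-2^-unbounded M with exceeding-ℕ M
... | K , M<K = K , λ e K≤e → ℚP.<-trans M<K (≐-< (≐-ℕ K) (c≐ (2 ^ e) (gap e)) (K<σ e K≤e))
  where
  gap : ∀ e → σ (2 ^ e) + 1 ≡ 2 * 2 ^ e
  gap e = trans (cong (_+ 1) (sym (*-identityˡ (σ (2 ^ e))))) (σ-prime-power e prime[2])
  K<σ : ∀ e → K ≤ e → K * 1 < σ (2 ^ e) * 1
  K<σ e K≤e = *-monoˡ-< 1 (<-≤-trans (≤-<-trans K≤e (n<m^n e (s≤s (s≤s z≤n)))) (n≤σ[n] (2 ^ e)))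

-- For a prime p = 3 + u, with P = p^e, s = σ(P) and d(P) = k + 1, these read
-- (p−2)·σ(P) + 2 = p·d(P) and (p−1)·d(P) = (p−2)·P + 1.
module _ (u s k P : ℕ) (σ-geometric : (2 + u) * s + 1 ≡ (3 + u) * P) (gap : s + suc k ≡ 2 * P) where

  prime-power-σ-deficiency : suc u * s + 2 ≡ (3 + u) * suc k
  prime-power-σ-deficiency = +-cancelˡ-≡ ((3 + u) * s) (suc u * s + 2) ((3 + u) * suc k) (begin
    (3 + u) * s + (suc u * s + 2) ≡⟨ double u s ⟩
    2 * ((2 + u) * s + 1)         ≡⟨ cong (2 *_) σ-geometric ⟩
    2 * ((3 + u) * P)             ≡⟨ swap u P ⟩
    (3 + u) * (2 * P)             ≡⟨ cong ((3 + u) *_) gap ⟨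
    (3 + u) * (s + suc k)         ≡⟨ *-distribˡ-+ (3 + u) s (suc k) ⟩
    (3 + u) * s + (3 + u) * suc k ∎)
    where
    open ≡-Reasoning
    double : ∀ u s → (3 + u) * s + (suc u * s + 2) ≡ 2 * ((2 + u) * s + 1)
    double = solve-∀
    swap : ∀ u P → 2 * ((3 + u) * P) ≡ (3 + u) * (2 * P)
    swap = solve-∀

  prime-power-deficiency : (2 + u) * suc k ≡ suc u * P + 1
  prime-power-deficiency = +-cancelˡ-≡ ((3 + u) * P) ((2 + u) * suc k) (suc u * P + 1) (begin
    (3 + u) * P + (2 + u) * suc k       ≡⟨ cong (_+ (2 + u) * suc k) σ-geometric ⟨
    (2 + u) * s + 1 + (2 + u) * suc k   ≡⟨ collect u s k ⟩
    (2 + u) * (s + suc k) + 1           ≡⟨ cong (λ t → (2 + u) * t + 1) gap ⟩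
    (2 + u) * (2 * P) + 1               ≡⟨ split u P ⟩
    (3 + u) * P + (suc u * P + 1)       ∎)
    where
    open ≡-Reasoning
    collect : ∀ u s k → (2 + u) * s + 1 + (2 + u) * suc k ≡ (2 + u) * (s + suc k) + 1
    collect = solve-∀
    split : ∀ u P → (2 + u) * (2 * P) + 1 ≡ (3 + u) * P + (suc u * P + 1)
    split = solve-∀

prime-power-c-deficit : ∀ u e k → Prime (3 + u) → σ ((3 + u) ^ e) + suc k ≡ 2 * (3 + u) ^ e →
  ℕ→ℚ (3 + u) ÷₀ ℕ→ℚ (suc u) ≡ c ((3 + u) ^ e) ℚ.+ ℕ→ℚ 2 ÷₀ ℕ→ℚ (suc u * suc k)
prime-power-c-deficit u e k pp gap =
  ≐-≡ (≐-ℕ÷ℕ (3 + u) u) (≐-+ (c≐ ((3 + u) ^ e) gap) (≐-ℕ÷ℕ 2 (k + u * suc k))) (begin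
    (3 + u) * suc (b + k * suc b)          ≡⟨ lhs k u ⟩
    suc k * suc u * ((3 + u) * suc k)      ≡⟨ cong (suc k * suc u *_) σ-deficiency ⟨
    suc k * suc u * (suc u * s + 2)        ≡⟨ rhs s k u ⟨
    (s * suc b + 2 * suc k) * suc u        ∎)
  where
  open ≡-Reasoning
  P = (3 + u) ^ e
  s = σ P
  b = k + u * suc k
  σ-deficiency : suc u * s + 2 ≡ (3 + u) * suc k
  σ-deficiency = prime-power-σ-deficiency u s k P (σ-prime-power e pp) gap
  lhs : ∀ k u → (3 + u) * suc ((k + u * suc k) + k * suc (k + u * suc k)) ≡ suc k * suc u * ((3 + u) * suc k)
  lhs = solve-∀
  rhs : ∀ s k u → (s * suc (k + u * suc k) + 2 * suc k) * suc u ≡ suc k * suc u * (suc u * s + 2)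
  rhs = solve-∀

∣x-[x+g]∣≡g : ∀ x g → 0ℚ ℚ.≤ g → ∣ x ℚ.- (x ℚ.+ g) ∣ ≡ g
∣x-[x+g]∣≡g x g 0≤g = begin
  ∣ x ℚ.- (x ℚ.+ g) ∣        ≡⟨ cong ∣_∣ (⁻¹-anti-homo‿- (x ℚ.+ g) x) ⟨
  ∣ ℚ.- (x ℚ.+ g ℚ.- x) ∣    ≡⟨ ℚP.∣-p∣≡∣p∣ (x ℚ.+ g ℚ.- x) ⟩
  ∣ x ℚ.+ g ℚ.- x ∣          ≡⟨ cong ∣_∣ (xyx⁻¹≈y x g) ⟩
  ∣ g ∣                      ≡⟨ ℚP.0≤p⇒∣p∣≡p 0≤g ⟩
  g                          ∎
  where open ≡-Reasoning

fraction-eventually-< : ∀ {ε} → 0ℚ ℚ.< ε → ∀ a → ∃[ N ] ∀ b → N ≤ b → ℕ→ℚ a ÷₀ ℕ→ℚ (suc b) ℚ.< ε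
fraction-eventually-< {mkℚ (ℤ.+ zero) d _} (ℚ.*<* (ℤ.+<+ ()))
fraction-eventually-< {mkℚ -[1+ n ] d _} (ℚ.*<* ())
fraction-eventually-< {ε@(mkℚ +[1+ n ] d _)} _ a = a * suc d , λ b N≤b →
  ≐-< {y = ε} (≐-ℕ÷ℕ a b) ℚᵘP.≃-refl (<-≤-trans (s≤s N≤b) (m≤n*m (suc b) (suc n)))

c-prime-power-limit : ∀ {p} → Prime p → 2 < p → ∀ ε → 0ℚ ℚ.< ε → ∃[ N ] ∀ e → N ≤ e →
  ∣ c (p ^ e) ℚ.- ℕ→ℚ p ÷₀ ℕ→ℚ (p ∸ 2) ∣ ℚ.< ε
c-prime-power-limit {suc (suc zero)} _ (s≤s (s≤s ()))
c-prime-power-limit {suc (suc (suc u))} pp _ ε 0<ε with fraction-eventually-< 0<ε 2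
... | N , small = (2 + u) * N , close
  where
  close : ∀ e → (2 + u) * N ≤ e → ∣ c ((3 + u) ^ e) ℚ.- ℕ→ℚ (3 + u) ÷₀ ℕ→ℚ (suc u) ∣ ℚ.< ε
  close e N≤e with deficiency-gap ((3 + u) ^ e) (prime-power-deficient e pp)
  ... | k , gap = subst (ℚ._< ε) (sym distance) (small (k + u * suc k) N≤b)
    where
    P = (3 + u) ^ e
    g = ℕ→ℚ 2 ÷₀ ℕ→ℚ (suc u * suc k)
    0≤g : 0ℚ ℚ.≤ g
    0≤g = ℚP.<⇒≤ (≐-< {0ℚ} ℚᵘP.≃-refl (≐-ℕ÷ℕ 2 (k + u * suc k)) (s≤s z≤n))
    distance : ∣ c P ℚ.- ℕ→ℚ (3 + u) ÷₀ ℕ→ℚ (suc u) ∣ ≡ g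
    distance = trans (cong (λ t → ∣ c P ℚ.- t ∣) (prime-power-c-deficit u e k pp gap)) (∣x-[x+g]∣≡g (c P) g 0≤g)
    N≤b : N ≤ k + u * suc k
    N≤b = ≤-pred (*-cancelˡ-< (2 + u) N (suc u * suc k) (begin-strict
      (2 + u) * N                ≤⟨ N≤e ⟩
      e                          <⟨ n<m^n e (s≤s (s≤s z≤n)) ⟩
      P                          ≤⟨ m≤n*m P (suc u) ⟩
      suc u * P                  <⟨ m<m+n (suc u * P) (s≤s z≤n) ⟩
      suc u * P + 1              ≡⟨ prime-power-deficiency u (σ P) k P (σ-prime-power e pp) gap ⟨
      (2 + u) * suc k            ≤⟨ *-monoʳ-≤ (2 + u) (m≤n*m (suc k) (suc u)) ⟩
      (2 + u) * (suc u * suc k)  ∎))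
      where open ≤-Reasoning

prime-coprime⇒∤ : ∀ {p m} → Prime p → Coprime p m → ¬ p ∣ m
prime-coprime⇒∤ pp cop p∣m = ¬prime[1] (subst Prime (cop (∣-refl , p∣m)) pp)

deficient-*-prime : ∀ {m r} → Deficient m → Prime r → ¬ r ∣ m → c m ℚ.< ℕ→ℚ r → Deficient (m * r)
deficient-*-prime {m} {r} dm pr r∤m cm<r with deficiency-gap m dm
... | k , gap = subst (_< 2 * (m * r)) (sym (σ-*-prime pr r∤m)) (begin-strict
  suc r * σ m          ≡⟨ +-comm (σ m) (r * σ m) ⟩
  r * σ m + σ m        <⟨ +-monoʳ-< (r * σ m) σ<rk ⟩
  r * σ m + r * suc k  ≡⟨ *-distribˡ-+ r (σ m) (suc k) ⟨
  r * (σ m + suc k)    ≡⟨ cong (r *_) gap ⟩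
  r * (2 * m)          ≡⟨ swap r m ⟩
  2 * (m * r)          ∎)
  where
  open ≤-Reasoning
  σ<rk : σ m < r * suc k
  σ<rk = subst (_< r * suc k) (*-identityʳ (σ m)) (≐-<⁻ (c≐ m gap) (≐-ℕ r) cm<r)
  swap : ∀ r m → r * (2 * m) ≡ 2 * (m * r)
  swap = solve-∀

c-*-prime-< : ∀ m {p q} → Deficient m → Prime p → Prime q → ¬ p ∣ m → ¬ q ∣ m → p < q →
  c m ℚ.< ℕ→ℚ p → c (m * q) ℚ.< c (m * p)
c-*-prime-< zero ()
c-*-prime-< (suc m) {p} {q} dm pp pq p∤m q∤m p<q cm<p =
  σ₋₁-<⇒c-< (suc m * q) (suc m * p) (deficient-*-prime dm pq q∤m cm<q) (deficient-*-prime dm pp p∤m cm<p)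
    (subst₂ _<_ (sym (scaled q p pq q∤m)) (sym (scaled p q pp p∤m)) (*-monoʳ-< (suc m) (*-monoʳ-< s 1+q*p<1+p*q)))
  where
  instance _ = >-nonZero (≤-trans (s≤s z≤n) (n≤σ[n] (suc m)))
  s = σ (suc m)
  cm<q : c (suc m) ℚ.< ℕ→ℚ q
  cm<q = ℚP.<-trans cm<p (≐-< (≐-ℕ p) (≐-ℕ q) (*-monoˡ-< 1 p<q))
  1+q*p<1+p*q : suc q * p < suc p * q
  1+q*p<1+p*q = subst (p + q * p <_) (cong (q +_) (*-comm q p)) (+-monoˡ-< (q * p) p<q)
  regroup : ∀ s m q p → suc q * s * (m * p) ≡ m * (s * (suc q * p))
  regroup = solve-∀
  scaled : ∀ q p → Prime q → ¬ q ∣ suc m → σ (suc m * q) * (suc m * p) ≡ suc m * (s * (suc q * p))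
  scaled q p pq q∤m = trans (cong (_* (suc m * p)) (σ-*-prime pq q∤m)) (regroup s (suc m) q p)

proposition2p7 :
    -- (1)
    (∀ (m : ℕ) → Deficient m →
        (c m ≡ ℕ→ℚ (2 ℕ.* m) ÷₀ ℤ→ℚ (def m) ℚ.- 1ℚ)
      × (c m ≡ 1ℚ ÷₀ (ℕ→ℚ 2 ÷₀ σ₋₁ m ℚ.- 1ℚ)))
    × -- (2)
    (∀ (m n : ℕ) → 1 ℕ.< n → Deficient (m ℕ.* n) → c m ℚ.< c (m ℕ.* n))
    × -- (3)
    (∀ (p : ℕ) → Prime p →
        (∀ (e : ℕ) → c (p ^ e) ℚ.< c (p ^ suc e))
      × (p ≡ 2 → ∀ (M : ℚ) → ∃[ N ] ∀ (e : ℕ) → N ℕ.≤ e → M ℚ.< c (p ^ e))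
      × (2 ℕ.< p → ∀ (ε : ℚ) → 0ℚ ℚ.< ε → ∃[ N ] ∀ (e : ℕ) → N ℕ.≤ e →
           ∣ c (p ^ e) ℚ.- ℕ→ℚ p ÷₀ ℕ→ℚ (p ℕ.∸ 2) ∣ ℚ.< ε))
    × -- (4)
    (∀ (m p q : ℕ) → Deficient m → Prime p → Prime q →
        Coprime p m → Coprime q m → p ℕ.< q → c m ℚ.< ℕ→ℚ p →
        c (m ℕ.* q) ℚ.< c (m ℕ.* p))
proposition2p7 =
    (λ m dm → c≡2m/d-1 m dm , c≡1/[2/σ₋₁-1] m dm)
  , c-<-*
  , (λ p pp → (λ e → c-prime-power-< e pp) , (λ { refl → c-2^-unbounded }) , c-prime-power-limit pp)
  , λ m p q dm pp pq p⊥m q⊥m → c-*-prime-< m dm pp pq (prime-coprime⇒∤ pp p⊥m) (prime-coprime⇒∤ pq q⊥m)
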